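{- Let $G$ be a circular-arc graph given by an intersection model $F$ as in the context, and let $v\in V(G)$ be such that $a(v)$ is a maximal arc in $F$ and the tail partner $p_t(v)$ and head partner $p_h(v)$ exist. Suppose $G$ has a paired-dominating set containing $v$, and call a paired-dominating set containing $v$ of minimum cardinality among all paired-dominating sets containing $v$ a $v$-minimum set. Then there exists a $v$-minimum set $S_v$ with $p_t(v)\in S_v$ or $p_h(v)\in S_v$.
   Context: For a graph $G$, a set $S\subseteq V(G)$ is a paired-dominating set if every vertex not in $S$ is adjacent to a vertex of $S$ and the induced subgraph $G[S]$ has a perfect matching. A circular-arc graph $G$ is given by an intersection model $F$: each vertex $v$ corresponds to an arc $a(v)=[h(v),t(v)]$ of a circle, where the head $h(v)$ precedes the tail $t(v)$ clockwise, two vertices being adjacent iff their arcs intersect; all endpoints are distinct and no arc covers the whole circle. An arc is maximal if it is not contained in any other arc of $F$. The tail partner $p_t(v)$ is the neighbour $u$ of $v$ with $t(v)\in a(u)$ whose tail $t(u)$ is the last one encountered moving clockwise from $t(v)$ among such neighbours; the head partner $p_h(v)$ is the neighbour $u$ of $v$ with $h(v)\in a(u)$ whose head $h(u)$ is the last one encountered moving counterclockwise from $h(v)$ among such neighbours. -}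

module Defs where

open import Data.Nat using (ℕ; _+_; _∸_; _≤_; _<_; NonZero)
open import Data.Nat.DivMod using (_%_)
open import Data.Fin using (Fin; toℕ)
open import Data.Fin.Subset using (Subset; _∈_; _∉_; ∣_∣)
open import Data.Product using (Σ; _×_; ∃)
open import Relation.Nullary using (¬_)
open import Relation.Binary.PropositionalEquality using (_≡_; _≢_)

-- The circle carries m (combinatorially distinguished) positions 0..m-1
-- in clockwise order; every arc endpoint sits at one of these positions.
-- Vertex i has the arc a(i) = [h i , t i], going clockwise from h i to t i.
record ArcModel (n : ℕ) : Set where
  field
    m        : ℕ
    .{{m≢0}} : NonZero m
    h        : Fin n → Fin m
    t        : Fin n → Fin m
    h-inj    : ∀ i j → h i ≡ h j → i ≡ j
    t-inj    : ∀ i j → t i ≡ t j → i ≡ j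
    h≢t      : ∀ i j → h i ≢ t j

module _ {n : ℕ} (F : ArcModel n) where
  open ArcModel F

  cw : Fin m → Fin m → ℕ
  cw x y = (m + toℕ y ∸ toℕ x) % m

  -- Points of the circle (up to combinatorial type): a position p,
  -- or the open gap strictly between position p and the next position.
  data Point : Set where
    pos : Fin m → Point
    gap : Fin m → Point

  OnArc : Fin m → Fin n → Set
  OnArc p v = cw (h v) p ≤ cw (h v) (t v)

  _∈A_ : Point → Fin n → Set
  pos p ∈A v = OnArc p v
  gap p ∈A v = cw (h v) p < cw (h v) (t v)

  Adj : Fin n → Fin n → Set
  Adj u v = u ≢ v × Σ Point (λ q → q ∈A u × q ∈A v)

  MaximalArc : Fin n → Set
  MaximalArc v = ∀ u → u ≢ v → ¬ (∀ q → q ∈A v → q ∈A u)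

  IsTailPartner : Fin n → Fin n → Set
  IsTailPartner v u =
    Adj v u × OnArc (t v) u ×
    (∀ w → Adj v w → OnArc (t v) w → cw (t v) (t w) ≤ cw (t v) (t u))

  -- u is the head partner p_h(v)  (counterclockwise distance from h v to h u
  -- equals the clockwise distance from h u to h v)
  IsHeadPartner : Fin n → Fin n → Set
  IsHeadPartner v u =
    Adj v u × OnArc (h v) u ×
    (∀ w → Adj v w → OnArc (h v) w → cw (h w) (h v) ≤ cw (h u) (h v))

  HasPerfectMatching : Subset n → Set
  HasPerfectMatching S =
    Σ (Fin n → Fin n) λ mate →
      ∀ x → x ∈ S → (mate x ∈ S) × Adj x (mate x) × (mate (mate x) ≡ x)

  Dominating : Subset n → Set
  Dominating S = ∀ x → x ∉ S → ∃ λ y → y ∈ S × Adj x y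

  PairedDominating : Subset n → Set
  PairedDominating S = Dominating S × HasPerfectMatching S

  VMinimum : Fin n → Subset n → Set
  VMinimum v S =
    PairedDominating S × v ∈ S ×
    (∀ S′ → PairedDominating S′ → v ∈ S′ → ∣ S ∣ ≤ ∣ S′ ∣)

-- Let S be a v-minimum set, w the partner of v in a perfect matching of S, and
-- suppose neither partner of v lies in S.  If t(v) ∈ a(w), maximality of a(v)
-- keeps h(v) out of the stretch of a(w) before t(v), so a(w) ⊆ a(v) ∪ a(p_t(v));
-- if only h(v) ∈ a(w), then a(w) ⊆ a(p_h(v)) ∪ a(v); if a(w) contains neither
-- endpoint of a(v), then a(w) ⊆ a(v).  So for p = p_t(v) or p = p_h(v) every
-- neighbour of w is adjacent to v or p, and replacing w by p in S while matching
-- v with p yields a paired-dominating set containing v and p, no larger than S.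

module Submission where

open import Defs
open import Data.Nat using (ℕ; zero; suc; _+_; _∸_; _≤_; _<_; _≤?_; _<?_; NonZero; z≤n; s≤s)
open import Data.Nat.Properties hiding (_≟_)
open import Data.Nat.DivMod
  using (_%_; m%n<n; m<n⇒m%n≡m; m≤n⇒[n∸m]%m≡n%m; %-distribˡ-+; [m+n]%n≡m%n)
open import Data.Nat.Induction using (<-rec)
open import Data.Nat.Tactic.RingSolver using (solve-∀)
open import Data.Fin using (Fin; zero; suc; toℕ; _≟_)
open import Data.Fin.Properties using (toℕ<n; any?; all?)
open import Data.Fin.Subset using (Subset; _∈_; _∉_; ∣_∣; _∪_; _─_; _-_; ⁅_⁆; inside; outside)
open import Data.Fin.Subset.Properties
  using ( _∈?_; anySubset?; x∈p∪q⁺; x∈p∪q⁻; x∈⁅x⁆; x∈⁅y⁆⇒x≡y; ∣⁅x⁆∣≡1; x∉⁅y⁆⇒x≢y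
        ; x∈p∧x≢y⇒x∈p-y; p─q⊆p; x∈p⇒∣p-x∣<∣p∣ )
open import Data.Vec using (_∷_; []; here; there)
open import Data.Product using (Σ; _×_; _,_; proj₁; proj₂; ∃)
import Data.Product as Prod
open import Data.Sum using (_⊎_; inj₁; inj₂)
import Data.Sum as Sum
open import Data.Empty using (⊥-elim)
open import Function using (_∘_)
open import Relation.Nullary using (¬_; Dec; yes; no; contradiction)
open import Relation.Nullary.Decidable using (_×-dec_; _⊎-dec_; _→-dec_; ¬?; map′)
open import Relation.Unary using (Pred; Decidable)
open import Relation.Binary.PropositionalEquality

m<n+n⇒m≡m%n⊎m≡m%n+n : ∀ {s} n .{{_ : NonZero n}} → s < n + n → s ≡ s % n ⊎ s ≡ s % n + n
m<n+n⇒m≡m%n⊎m≡m%n+n {s} n s<2n with s <? n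
... | yes s<n = inj₁ (sym (m<n⇒m%n≡m s<n))
... | no s≮n = inj₂ (begin
  s               ≡⟨ m∸n+n≡m n≤s ⟨
  (s ∸ n) + n     ≡⟨ cong (_+ n) (m<n⇒m%n≡m s∸n<n) ⟨
  (s ∸ n) % n + n ≡⟨ cong (_+ n) (m≤n⇒[n∸m]%m≡n%m n≤s) ⟩
  s % n + n       ∎)
  where
  open ≡-Reasoning
  n≤s = ≮⇒≥ s≮n
  s∸n<n : s ∸ n < n
  s∸n<n = +-cancelʳ-< n (s ∸ n) n (subst (_< n + n) (sym (m∸n+n≡m n≤s)) s<2n)

[m+y∸x]+[m+z∸y]≡[m+z∸x]+m : ∀ {m x y} z → x ≤ m → y ≤ m →
  (m + y ∸ x) + (m + z ∸ y) ≡ (m + z ∸ x) + m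
[m+y∸x]+[m+z∸y]≡[m+z∸x]+m {m} {x} {y} z x≤m y≤m = begin
  (m + y ∸ x) + (m + z ∸ y)     ≡⟨ cong₂ _+_ (+-∸-comm y x≤m) (+-∸-comm z y≤m) ⟩
  (m ∸ x + y) + (m ∸ y + z)     ≡⟨ rearrange (m ∸ x) y (m ∸ y) z ⟩
  (m ∸ x + z) + (y + (m ∸ y))   ≡⟨ cong₂ _+_ (sym (+-∸-comm z x≤m)) (m+[n∸m]≡n y≤m) ⟩
  (m + z ∸ x) + m               ∎
  where
  open ≡-Reasoning
  rearrange : ∀ a y b z → (a + y) + (b + z) ≡ (a + z) + (y + b)
  rearrange = solve-∀

∣p∪q∣≤∣p∣+∣q∣ : ∀ {n} (p q : Subset n) → ∣ p ∪ q ∣ ≤ ∣ p ∣ + ∣ q ∣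
∣p∪q∣≤∣p∣+∣q∣ []            []            = z≤n
∣p∪q∣≤∣p∣+∣q∣ (inside  ∷ p) (inside  ∷ q) =
  s≤s (≤-trans (∣p∪q∣≤∣p∣+∣q∣ p q) (+-monoʳ-≤ ∣ p ∣ (n≤1+n _)))
∣p∪q∣≤∣p∣+∣q∣ (inside  ∷ p) (outside ∷ q) = s≤s (∣p∪q∣≤∣p∣+∣q∣ p q)
∣p∪q∣≤∣p∣+∣q∣ (outside ∷ p) (inside  ∷ q) =
  subst (∣ p ∪ q ∣ <_) (sym (+-suc ∣ p ∣ ∣ q ∣)) (s≤s (∣p∪q∣≤∣p∣+∣q∣ p q))
∣p∪q∣≤∣p∣+∣q∣ (outside ∷ p) (outside ∷ q) = ∣p∪q∣≤∣p∣+∣q∣ p q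

x∈p─q⇒x∉q : ∀ {n} {x : Fin n} (p q : Subset n) → x ∈ p ─ q → x ∉ q
x∈p─q⇒x∉q (inside ∷ p) (outside ∷ q) here       ()
x∈p─q⇒x∉q (_      ∷ p) (_       ∷ q) (there x∈) (there x∈q) = x∈p─q⇒x∉q p q x∈ x∈q

x∈p-y⇒x≢y : ∀ {n} {x y : Fin n} (p : Subset n) → x ∈ p - y → x ≢ y
x∈p-y⇒x≢y {y = y} p = x∉⁅y⁆⇒x≢y ∘ x∈p─q⇒x∉q p ⁅ y ⁆

anyFunction? : ∀ k {n p} {P : Pred (Fin k → Fin n) p} →
  (∀ {f g} → (∀ i → f i ≡ g i) → P f → P g) → Decidable P → Dec (∃ P)
anyFunction? zero {n} resp-≗ P? = map′ (empty ,_) (λ (f , Pf) → resp-≗ (λ ()) Pf) (P? empty)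
  where
  empty : Fin zero → Fin n
  empty ()
anyFunction? (suc k) resp-≗ P? =
  map′ (λ (a , f , Pf) → cons a f , Pf)
       (λ (f , Pf) → f zero , f ∘ suc , resp-≗ (λ { zero → refl ; (suc i) → refl }) Pf)
       (any? λ a → anyFunction? k (resp-≗ ∘ cons-cong a) (P? ∘ cons a))
  where
  cons : ∀ {n} → Fin n → (Fin k → Fin n) → Fin (suc k) → Fin n
  cons a f zero    = a
  cons a f (suc i) = f i
  cons-cong : ∀ {n} (a : Fin n) {f g} → (∀ i → f i ≡ g i) → ∀ i → cons a f i ≡ cons a g i
  cons-cong a f≗g zero    = refl
  cons-cong a f≗g (suc i) = f≗g i

minimal-subset : ∀ {n p} {P : Pred (Subset n) p} → Decidable P → ∃ P →
  ∃ λ S → P S × (∀ S′ → P S′ → ∣ S ∣ ≤ ∣ S′ ∣)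
minimal-subset {P = P} P? (S₀ , PS₀) = <-rec Minimal-from step ∣ S₀ ∣ S₀ refl PS₀
  where
  Minimum : Set _
  Minimum = ∃ λ S → P S × (∀ S′ → P S′ → ∣ S ∣ ≤ ∣ S′ ∣)
  Minimal-from : ℕ → Set _
  Minimal-from k = ∀ S → ∣ S ∣ ≡ k → P S → Minimum
  step : ∀ k → (∀ {j} → j < k → Minimal-from j) → Minimal-from k
  step _ rec S refl PS with anySubset? (λ S′ → P? S′ ×-dec ∣ S′ ∣ <? ∣ S ∣)
  ... | yes (S′ , PS′ , smaller) = rec smaller S′ refl PS′
  ... | no no-smaller = S , PS , λ S′ PS′ → ≮⇒≥ (λ smaller → no-smaller (S′ , PS′ , smaller))

replace : ∀ {n} → Subset n → Fin n → Fin n → Subset n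
replace S w p = (S - w) ∪ ⁅ p ⁆

module _ {n} {S : Subset n} {w p : Fin n} where

  x∈S∧x≢w⇒x∈replace : ∀ {x} → x ∈ S → x ≢ w → x ∈ replace S w p
  x∈S∧x≢w⇒x∈replace x∈S x≢w = x∈p∪q⁺ (inj₁ (x∈p∧x≢y⇒x∈p-y x∈S x≢w))

  p∈replace : p ∈ replace S w p
  p∈replace = x∈p∪q⁺ (inj₂ (x∈⁅x⁆ p))

  x∈replace⇒x≡p⊎x∈S∧x≢w : ∀ {x} → x ∈ replace S w p → x ≡ p ⊎ (x ∈ S × x ≢ w)
  x∈replace⇒x≡p⊎x∈S∧x≢w x∈ with x∈p∪q⁻ (S - w) ⁅ p ⁆ x∈
  ... | inj₁ x∈S-w = inj₂ (p─q⊆p S ⁅ w ⁆ x∈S-w , x∈p-y⇒x≢y S x∈S-w)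
  ... | inj₂ x∈⁅p⁆ = inj₁ (x∈⁅y⁆⇒x≡y p x∈⁅p⁆)

  ∣replace∣≤∣S∣ : w ∈ S → ∣ replace S w p ∣ ≤ ∣ S ∣
  ∣replace∣≤∣S∣ w∈S = begin
    ∣ (S - w) ∪ ⁅ p ⁆ ∣     ≤⟨ ∣p∪q∣≤∣p∣+∣q∣ (S - w) ⁅ p ⁆ ⟩
    ∣ S - w ∣ + ∣ ⁅ p ⁆ ∣   ≡⟨ cong (∣ S - w ∣ +_) (∣⁅x⁆∣≡1 p) ⟩
    ∣ S - w ∣ + 1           ≡⟨ +-comm ∣ S - w ∣ 1 ⟩
    suc ∣ S - w ∣           ≤⟨ x∈p⇒∣p-x∣<∣p∣ w∈S ⟩
    ∣ S ∣                   ∎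
    where open ≤-Reasoning

rematch : ∀ {n} → Fin n → Fin n → (Fin n → Fin n) → Fin n → Fin n
rematch v p mate x with x ≟ v | x ≟ p
... | yes _ | _     = p
... | no _  | yes _ = v
... | no _  | no _  = mate x

module _ {n} {v p : Fin n} {mate : Fin n → Fin n} where

  rematch-v : rematch v p mate v ≡ p
  rematch-v with v ≟ v | v ≟ p
  ... | yes _   | _ = refl
  ... | no  v≢v | _ = contradiction refl v≢v

  rematch-p : p ≢ v → rematch v p mate p ≡ v
  rematch-p p≢v with p ≟ v | p ≟ p
  ... | yes p≡v | _       = contradiction p≡v p≢v
  ... | no  _   | yes _   = refl
  ... | no  _   | no  p≢p = contradiction refl p≢p

  rematch-other : ∀ {x} → x ≢ v → x ≢ p → rematch v p mate x ≡ mate x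
  rematch-other {x} x≢v x≢p with x ≟ v | x ≟ p
  ... | yes x≡v | _       = contradiction x≡v x≢v
  ... | no  _   | yes x≡p = contradiction x≡p x≢p
  ... | no  _   | no  _   = refl

module _ {n : ℕ} (F : ArcModel n) where
  open ArcModel F

  cw-triangle : ∀ x y z → cw F x y + cw F y z ≡ cw F x z ⊎ cw F x y + cw F y z ≡ cw F x z + m
  cw-triangle x y z = Sum.map (λ e → trans e sum%m) (λ e → trans e (cong (_+ m) sum%m))
    (m<n+n⇒m≡m%n⊎m≡m%n+n m (+-mono-< (m%n<n _ m) (m%n<n _ m)))
    where
    open ≡-Reasoning
    x′ = toℕ x ; y′ = toℕ y ; z′ = toℕ z
    difference-sum : x′ < m → y′ < m → (m + y′ ∸ x′) + (m + z′ ∸ y′) ≡ (m + z′ ∸ x′) + m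
    difference-sum x′<m y′<m = [m+y∸x]+[m+z∸y]≡[m+z∸x]+m z′ (<⇒≤ x′<m) (<⇒≤ y′<m)
    sum%m : (cw F x y + cw F y z) % m ≡ cw F x z
    sum%m = begin
      (cw F x y + cw F y z) % m           ≡⟨ %-distribˡ-+ (m + y′ ∸ x′) (m + z′ ∸ y′) m ⟨
      ((m + y′ ∸ x′) + (m + z′ ∸ y′)) % m ≡⟨ cong (_% m) (difference-sum (toℕ<n x) (toℕ<n y)) ⟩
      ((m + z′ ∸ x′) + m) % m             ≡⟨ [m+n]%n≡m%n (m + z′ ∸ x′) m ⟩
      cw F x z                            ∎

  -- Twice the clockwise distance from a position to a point; the gap after a
  -- position sits half a step past it.
  δ : Fin m → Point F → ℕ
  δ a (pos p) = cw F a p + cw F a p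
  δ a (gap p) = suc (cw F a p + cw F a p)

  δ<m+m : ∀ a q → δ a q < m + m
  δ<m+m a (pos p) = +-mono-< (m%n<n _ m) (m%n<n _ m)
  δ<m+m a (gap p) = subst (_≤ m + m) (cong suc (+-suc _ _)) (+-mono-≤ (m%n<n _ m) (m%n<n _ m))

  δ-triangle : ∀ a c q → δ a (pos c) + δ c q ≡ δ a q ⊎ δ a (pos c) + δ c q ≡ δ a q + (m + m)
  δ-triangle a c (pos p) = Sum.map
    (λ e → trans (twice-sum (cw F a c) (cw F c p)) (cong₂ _+_ e e))
    (λ e → trans (twice-sum (cw F a c) (cw F c p))
                 (trans (cong₂ _+_ e e) (sym (twice-sum (cw F a p) m))))
    (cw-triangle a c p)
    where
    twice-sum : ∀ x y → (x + x) + (y + y) ≡ (x + y) + (x + y)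
    twice-sum = solve-∀
  δ-triangle a c (gap p) =
    Sum.map (λ e → trans (+-suc _ _) (cong suc e)) (λ e → trans (+-suc _ _) (cong suc e))
            (δ-triangle a c (pos p))

  δ-additive : ∀ a c q → δ a (pos c) ≤ δ a q → δ a (pos c) + δ c q ≡ δ a q
  δ-additive a c q c≤q with δ-triangle a c q
  ... | inj₁ e = e
  ... | inj₂ e = ⊥-elim (<-irrefl e (+-mono-≤-< c≤q (δ<m+m c q)))

  δ-wraps : ∀ a c q → δ a q < δ a (pos c) → δ a (pos c) + δ c q ≡ δ a q + (m + m)
  δ-wraps a c q q<c with δ-triangle a c q
  ... | inj₁ e = ⊥-elim (<⇒≱ q<c (subst (δ a (pos c) ≤_) e (m≤m+n _ _)))
  ... | inj₂ e = e

  infix 4 _∈ᵃ_ _∈[_,_] _∈[_,_]?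
  _∈ᵃ_ : Point F → Fin n → Set
  q ∈ᵃ u = _∈A_ F q u

  record _∈[_,_] (q : Point F) (a b : Fin m) : Set where
    constructor within
    field δ≤δ : δ a q ≤ δ a (pos b)

  _∈[_,_]? : ∀ q a b → Dec (q ∈[ a , b ])
  q ∈[ a , b ]? = map′ within _∈[_,_].δ≤δ (δ a q ≤? δ a (pos b))

  ∈ᵃ⇒∈[h,t] : ∀ {q u} → q ∈ᵃ u → q ∈[ h u , t u ]
  ∈ᵃ⇒∈[h,t] {pos p} p∈u = within (+-mono-≤ p∈u p∈u)
  ∈ᵃ⇒∈[h,t] {gap p} p∈u = within (+-mono-≤ p∈u (<⇒≤ p∈u))

  ∈[h,t]⇒∈ᵃ : ∀ {q u} → q ∈[ h u , t u ] → q ∈ᵃ u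
  ∈[h,t]⇒∈ᵃ {pos p} {u} (within p∈u) with cw F (h u) p ≤? cw F (h u) (t u)
  ... | yes le = le
  ... | no  gt = contradiction p∈u (<⇒≱ (+-mono-< (≰⇒> gt) (≰⇒> gt)))
  ∈[h,t]⇒∈ᵃ {gap p} {u} (within p∈u) with cw F (h u) p <? cw F (h u) (t u)
  ... | yes lt = lt
  ... | no  ge = contradiction p∈u (<⇒≱ (s≤s (+-mono-≤ (≮⇒≥ ge) (≮⇒≥ ge))))

  c∈[a,b]⇒[a,c]⊆[a,b] : ∀ {a b c q} → pos c ∈[ a , b ] → q ∈[ a , c ] → q ∈[ a , b ]
  c∈[a,b]⇒[a,c]⊆[a,b] (within c∈) (within q∈) = within (≤-trans q∈ c∈)

  b∉[a,c]⇒[a,c]⊆[a,b] : ∀ {a b c q} → ¬ pos b ∈[ a , c ] → q ∈[ a , c ] → q ∈[ a , b ]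
  b∉[a,c]⇒[a,c]⊆[a,b] b∉ (within q∈) = within (≤-trans q∈ (<⇒≤ (≰⇒> (b∉ ∘ within))))

  c∈[a,b]⇒[c,b]⊆[a,b] : ∀ {a b c q} → pos c ∈[ a , b ] → q ∈[ c , b ] → q ∈[ a , b ]
  c∈[a,b]⇒[c,b]⊆[a,b] {a} {b} {c} {q} (within c∈) (within q∈)
    with δ a q <? δ a (pos c)
  ... | yes q-before-c = within (≤-trans (<⇒≤ q-before-c) c∈)
  ... | no  q-after-c  = within (begin
    δ a q                     ≡⟨ δ-additive a c q (≮⇒≥ q-after-c) ⟨
    δ a (pos c) + δ c q       ≤⟨ +-monoʳ-≤ (δ a (pos c)) q∈ ⟩
    δ a (pos c) + δ c (pos b) ≡⟨ δ-additive a c (pos b) c∈ ⟩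
    δ a (pos b)               ∎)
    where open ≤-Reasoning

  c∈[a,b]⇒[a,b]⊆[a,c]∪[c,b] : ∀ {a b c q} → pos c ∈[ a , b ] → q ∈[ a , b ] →
    q ∈[ a , c ] ⊎ q ∈[ c , b ]
  c∈[a,b]⇒[a,b]⊆[a,c]∪[c,b] {a} {b} {c} {q} (within c∈) (within q∈)
    with δ a q ≤? δ a (pos c)
  ... | yes q∈[a,c] = inj₁ (within q∈[a,c])
  ... | no  q∉[a,c] = inj₂ (within (+-cancelˡ-≤ (δ a (pos c)) _ _ (begin
    δ a (pos c) + δ c q       ≡⟨ δ-additive a c q (<⇒≤ (≰⇒> q∉[a,c])) ⟩
    δ a q                     ≤⟨ q∈ ⟩
    δ a (pos b)               ≡⟨ δ-additive a c (pos b) c∈ ⟨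
    δ a (pos c) + δ c (pos b) ∎)))
    where open ≤-Reasoning

  a∉[c,b]⇒[c,b]⊆[a,b] : ∀ {a b c q} → ¬ pos a ∈[ c , b ] → q ∈[ c , b ] → q ∈[ a , b ]
  a∉[c,b]⇒[c,b]⊆[a,b] {a} {b} {c} {q} a∉ (within q∈) =
    within (+-cancelˡ-≤ (δ c (pos a)) _ _ (begin
    δ c (pos a) + δ a q       ≡⟨ δ-wraps c a q (≤-<-trans q∈ b-before-a) ⟩
    δ c q + (m + m)           ≤⟨ +-monoˡ-≤ (m + m) q∈ ⟩
    δ c (pos b) + (m + m)     ≡⟨ δ-wraps c a (pos b) b-before-a ⟨
    δ c (pos a) + δ a (pos b) ∎))
    where
    open ≤-Reasoning
    b-before-a = ≰⇒> (a∉ ∘ within)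

  cw[c,b]≤cw[a,b]⇒c∈[a,b] : ∀ {a b c} → cw F c b ≤ cw F a b → pos c ∈[ a , b ]
  cw[c,b]≤cw[a,b]⇒c∈[a,b] {a} {b} {c} c-closer with δ a (pos c) ≤? δ a (pos b)
  ... | yes c∈ = within c∈
  ... | no  c∉ = ⊥-elim (<-irrefl (trans (δ-wraps a c (pos b) (≰⇒> c∉)) (+-comm _ (m + m)))
                                  (+-mono-<-≤ (δ<m+m a (pos c)) (+-mono-≤ c-closer c-closer)))

  -- Otherwise the trips a → c → q and c → a → q both wrap around, so a → c → a
  -- would take two full turns.
  q∈[a,b]∩[c,e]⇒c∈[a,b]⊎a∈[c,e] : ∀ {a b c e q} → q ∈[ a , b ] → q ∈[ c , e ] →
    pos c ∈[ a , b ] ⊎ pos a ∈[ c , e ]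
  q∈[a,b]∩[c,e]⇒c∈[a,b]⊎a∈[c,e] {a} {b} {c} {e} {q} (within q∈ab) (within q∈ce)
    with δ a (pos c) ≤? δ a q | δ c (pos a) ≤? δ c q
  ... | yes c-first | _           = inj₁ (within (≤-trans c-first q∈ab))
  ... | no  _       | yes a-first = inj₂ (within (≤-trans a-first q∈ce))
  ... | no  q<c     | no q<a      =
    ⊥-elim (<-irrefl two-turns (+-mono-< (δ<m+m a (pos c)) (δ<m+m c (pos a))))
    where
    open ≡-Reasoning
    A = δ a (pos c) ; A′ = δ c (pos a) ; B = δ c q ; C = δ a q ; N = m + m
    two-turns : A + A′ ≡ N + N
    two-turns = +-cancelʳ-≡ (B + C) _ _ (begin
      (A + A′) + (B + C) ≡⟨ regroup A A′ B C ⟩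
      (A + B) + (A′ + C) ≡⟨ cong₂ _+_ (δ-wraps a c q (≰⇒> q<c)) (δ-wraps c a q (≰⇒> q<a)) ⟩
      (C + N) + (B + N)  ≡⟨ collect C N B ⟩
      (N + N) + (B + C)  ∎)
      where
      regroup : ∀ x y z w → (x + y) + (z + w) ≡ (x + z) + (y + w)
      regroup = solve-∀
      collect : ∀ x y z → (x + y) + (z + y) ≡ (y + y) + (z + x)
      collect = solve-∀

  ArcCoveredBy : Fin n → Fin n → Fin n → Set
  ArcCoveredBy w v p = ∀ q → q ∈ᵃ w → q ∈ᵃ v ⊎ q ∈ᵃ p

  tail-partner-covers : ∀ {v w pt} → MaximalArc F v → IsTailPartner F v pt → Adj F v w →
    OnArc F (t v) w → ArcCoveredBy w v pt
  tail-partner-covers {v} {w} {pt} maximal (_ , tv∈pt , farthest) v~w tv∈w q q∈w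
    with c∈[a,b]⇒[a,b]⊆[a,c]∪[c,b] (∈ᵃ⇒∈[h,t] {pos (t v)} tv∈w) (∈ᵃ⇒∈[h,t] q∈w)
  ... | inj₂ q∈[tv,tw] = inj₂ (∈[h,t]⇒∈ᵃ (c∈[a,b]⇒[c,b]⊆[a,b] (∈ᵃ⇒∈[h,t] {pos (t v)} tv∈pt)
                                             (c∈[a,b]⇒[a,c]⊆[a,b] tw∈[tv,tpt] q∈[tv,tw])))
    where
    tw∈[tv,tpt] : pos (t w) ∈[ t v , t pt ]
    tw∈[tv,tpt] = within (+-mono-≤ (farthest w v~w tv∈w) (farthest w v~w tv∈w))
  ... | inj₁ q∈[hw,tv] with pos (h v) ∈[ h w , t v ]?
  ...   | no  hv∉[hw,tv] = inj₁ (∈[h,t]⇒∈ᵃ (a∉[c,b]⇒[c,b]⊆[a,b] hv∉[hw,tv] q∈[hw,tv]))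
  ...   | yes hv∈[hw,tv] = ⊥-elim (maximal w (proj₁ v~w ∘ sym) λ q′ q′∈v →
    ∈[h,t]⇒∈ᵃ (c∈[a,b]⇒[a,c]⊆[a,b] (∈ᵃ⇒∈[h,t] {pos (t v)} tv∈w)
                 (c∈[a,b]⇒[c,b]⊆[a,b] hv∈[hw,tv] (∈ᵃ⇒∈[h,t] q′∈v))))

  head-partner-covers : ∀ {v w ph} → IsHeadPartner F v ph → Adj F v w →
    ¬ OnArc F (t v) w → OnArc F (h v) w → ArcCoveredBy w v ph
  head-partner-covers {v} {w} {ph} (_ , hv∈ph , farthest) v~w tv∉w hv∈w q q∈w
    with c∈[a,b]⇒[a,b]⊆[a,c]∪[c,b] (∈ᵃ⇒∈[h,t] {pos (h v)} hv∈w) (∈ᵃ⇒∈[h,t] q∈w)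
  ... | inj₁ q∈[hw,hv] = inj₂ (∈[h,t]⇒∈ᵃ (c∈[a,b]⇒[a,c]⊆[a,b] (∈ᵃ⇒∈[h,t] {pos (h v)} hv∈ph)
                                             (c∈[a,b]⇒[c,b]⊆[a,b] hw∈[hph,hv] q∈[hw,hv])))
    where
    hw∈[hph,hv] : pos (h w) ∈[ h ph , h v ]
    hw∈[hph,hv] = cw[c,b]≤cw[a,b]⇒c∈[a,b] (farthest w v~w hv∈w)
  ... | inj₂ q∈[hv,tw] = inj₁ (∈[h,t]⇒∈ᵃ (b∉[a,c]⇒[a,c]⊆[a,b] tv∉[hv,tw] q∈[hv,tw]))
    where
    tv∉[hv,tw] : ¬ pos (t v) ∈[ h v , t w ]
    tv∉[hv,tw] = tv∉w ∘ ∈[h,t]⇒∈ᵃ ∘ c∈[a,b]⇒[c,b]⊆[a,b] (∈ᵃ⇒∈[h,t] {pos (h v)} hv∈w)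

  no-endpoint⇒arc⊆ : ∀ {v w} → Adj F v w → ¬ OnArc F (t v) w → ¬ OnArc F (h v) w →
    ∀ q → q ∈ᵃ w → q ∈ᵃ v
  no-endpoint⇒arc⊆ {v} {w} (_ , q₀ , q₀∈v , q₀∈w) tv∉w hv∉w q q∈w
    with q∈[a,b]∩[c,e]⇒c∈[a,b]⊎a∈[c,e] (∈ᵃ⇒∈[h,t] q₀∈v) (∈ᵃ⇒∈[h,t] q₀∈w)
  ... | inj₂ hv∈w       = contradiction (∈[h,t]⇒∈ᵃ hv∈w) hv∉w
  ... | inj₁ hw∈[hv,tv] = ∈[h,t]⇒∈ᵃ (c∈[a,b]⇒[c,b]⊆[a,b] hw∈[hv,tv]
                            (b∉[a,c]⇒[a,c]⊆[a,b] (tv∉w ∘ ∈[h,t]⇒∈ᵃ) (∈ᵃ⇒∈[h,t] q∈w)))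

  neighbour-arc-covered : ∀ {v w pt ph} →
    MaximalArc F v → IsTailPartner F v pt → IsHeadPartner F v ph → Adj F v w →
    ArcCoveredBy w v pt ⊎ ArcCoveredBy w v ph
  neighbour-arc-covered {v} {w} maximal tail head v~w
    with cw F (h w) (t v) ≤? cw F (h w) (t w) | cw F (h w) (h v) ≤? cw F (h w) (t w)
  ... | yes tv∈w | _        = inj₁ (tail-partner-covers maximal tail v~w tv∈w)
  ... | no  tv∉w | yes hv∈w = inj₂ (head-partner-covers head v~w tv∉w hv∈w)
  ... | no  tv∉w | no  hv∉w = inj₁ (λ q q∈w → inj₁ (no-endpoint⇒arc⊆ v~w tv∉w hv∉w q q∈w))

  adj-sym : ∀ {x y} → Adj F x y → Adj F y x
  adj-sym (x≢y , q , q∈x , q∈y) = x≢y ∘ sym , q , q∈y , q∈x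

  arc-covered⇒adj : ∀ {w v p x} → ArcCoveredBy w v p → Adj F x w → x ≢ v → x ≢ p →
    Adj F x v ⊎ Adj F x p
  arc-covered⇒adj covered (_ , q , q∈x , q∈w) x≢v x≢p with covered q q∈w
  ... | inj₁ q∈v = inj₁ (x≢v , q , q∈x , q∈v)
  ... | inj₂ q∈p = inj₂ (x≢p , q , q∈x , q∈p)

  replace-dominating : ∀ {S v w p} → Dominating F S → v ∈ S → Adj F v w → ArcCoveredBy w v p →
    Dominating F (replace S w p)
  replace-dominating {S} {v} {w} {p} dom v∈S v~w covered = dominated
    where
    v∈S′ : v ∈ replace S w p
    v∈S′ = x∈S∧x≢w⇒x∈replace v∈S (proj₁ v~w)
    outside⇒≢ : ∀ {x y} → x ∉ replace S w p → y ∈ replace S w p → x ≢ y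
    outside⇒≢ x∉ y∈ refl = x∉ y∈
    dominated : Dominating F (replace S w p)
    dominated x x∉ with x ≟ w
    ... | yes refl = v , v∈S′ , adj-sym v~w
    ... | no x≢w with dom x (x∉ ∘ λ x∈S → x∈S∧x≢w⇒x∈replace x∈S x≢w)
    ...   | y , y∈S , x~y with y ≟ w
    ...     | no y≢w = y , x∈S∧x≢w⇒x∈replace y∈S y≢w , x~y
    ...     | yes refl
      with arc-covered⇒adj covered x~y (outside⇒≢ x∉ v∈S′) (outside⇒≢ x∉ p∈replace)
    ...       | inj₁ x~v = v , v∈S′ , x~v
    ...       | inj₂ x~p = p , p∈replace , x~p

  IsPerfectMatching : Subset n → (Fin n → Fin n) → Set
  IsPerfectMatching S mate = ∀ x → x ∈ S → (mate x ∈ S) × Adj F x (mate x) × (mate (mate x) ≡ x)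

  rematch-perfect : ∀ {S v p mate} → IsPerfectMatching S mate → v ∈ S → p ∉ S → Adj F v p →
    IsPerfectMatching (replace S (mate v) p) (rematch v p mate)
  rematch-perfect {S} {v} {p} {mate} matched v∈S p∉S v~p x x∈S′ = by-cases (x ≟ v) (x ≟ p)
    where
    S′ = replace S (mate v) p
    mate′ = rematch v p mate
    Matched : Fin n → Set
    Matched x = (mate′ x ∈ S′) × Adj F x (mate′ x) × (mate′ (mate′ x) ≡ x)
    paired : ∀ {x y} → mate′ x ≡ y → mate′ y ≡ x → y ∈ S′ → Adj F x y → Matched x
    paired refl back y∈S′ x~y = y∈S′ , x~y , back
    p≢v : p ≢ v
    p≢v p≡v = p∉S (subst (_∈ S) (sym p≡v) v∈S)
    v≢w : v ≢ mate v
    v≢w = proj₁ (proj₁ (proj₂ (matched v v∈S)))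
    mate-w≡v : mate (mate v) ≡ v
    mate-w≡v = proj₂ (proj₂ (matched v v∈S))
    by-cases : Dec (x ≡ v) → Dec (x ≡ p) → Matched x
    by-cases (yes x≡v) _ = subst Matched (sym x≡v)
      (paired (rematch-v {v = v} {mate = mate}) (rematch-p p≢v) p∈replace v~p)
    by-cases (no _) (yes x≡p) = subst Matched (sym x≡p)
      (paired (rematch-p p≢v) (rematch-v {v = v} {mate = mate}) (x∈S∧x≢w⇒x∈replace v∈S v≢w) (adj-sym v~p))
    by-cases (no x≢v) (no x≢p) with x∈replace⇒x≡p⊎x∈S∧x≢w x∈S′
    ... | inj₁ x≡p = contradiction x≡p x≢p
    ... | inj₂ (x∈S , x≢w) with matched x x∈S
    ...   | y∈S , x~y , mate-y≡x = paired (rematch-other x≢v x≢p)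
      (trans (rematch-other y≢v y≢p) mate-y≡x) (x∈S∧x≢w⇒x∈replace y∈S y≢w) x~y
      where
      y≢v : mate x ≢ v
      y≢v y≡v = x≢w (trans (sym mate-y≡x) (cong mate y≡v))
      y≢w : mate x ≢ mate v
      y≢w y≡w = x≢v (trans (sym mate-y≡x) (trans (cong mate y≡w) mate-w≡v))
      y≢p : mate x ≢ p
      y≢p y≡p = p∉S (subst (_∈ S) y≡p y∈S)

  replace-partner-vMinimum : ∀ {S v p} mate → Dominating F S → IsPerfectMatching S mate → v ∈ S →
    (∀ S′ → PairedDominating F S′ → v ∈ S′ → ∣ S ∣ ≤ ∣ S′ ∣) →
    p ∉ S → Adj F v p → ArcCoveredBy (mate v) v p →
    VMinimum F v (replace S (mate v) p) × p ∈ replace S (mate v) p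
  replace-partner-vMinimum {S} {v} {p} mate dom matched v∈S minimal p∉S v~p covered with matched v v∈S
  ... | w∈S , v~w , _ =
    ( (replace-dominating dom v∈S v~w covered , rematch v p mate , rematch-perfect matched v∈S p∉S v~p)
    , x∈S∧x≢w⇒x∈replace v∈S (proj₁ v~w)
    , λ S′ pd′ v∈S′ → ≤-trans (∣replace∣≤∣S∣ w∈S) (minimal S′ pd′ v∈S′) )
    , p∈replace

  _∈ᵃ?_ : ∀ q u → Dec (q ∈ᵃ u)
  pos p ∈ᵃ? u = _ ≤? _
  gap p ∈ᵃ? u = _ <? _

  anyPoint? : ∀ {ℓ} {P : Pred (Point F) ℓ} → Decidable P → Dec (∃ P)
  anyPoint? P? = map′ from-pos⊎gap to-pos⊎gap (any? (P? ∘ pos) ⊎-dec any? (P? ∘ gap))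
    where
    from-pos⊎gap = λ { (inj₁ (p , Pq)) → pos p , Pq ; (inj₂ (p , Pq)) → gap p , Pq }
    to-pos⊎gap   = λ { (pos p , Pq) → inj₁ (p , Pq) ; (gap p , Pq) → inj₂ (p , Pq) }

  adj? : ∀ u v → Dec (Adj F u v)
  adj? u v = ¬? (u ≟ v) ×-dec anyPoint? (λ q → q ∈ᵃ? u ×-dec q ∈ᵃ? v)

  dominating? : Decidable (Dominating F)
  dominating? S = all? λ x → ¬? (x ∈? S) →-dec any? λ y → y ∈? S ×-dec adj? x y

  perfectMatching? : Decidable (HasPerfectMatching F)
  perfectMatching? S = anyFunction? n matching-resp-≗ λ mate →
    all? λ x → x ∈? S →-dec (mate x ∈? S ×-dec adj? x (mate x) ×-dec mate (mate x) ≟ x)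
    where
    matching-resp-≗ : ∀ {f g} → (∀ i → f i ≡ g i) → IsPerfectMatching S f → IsPerfectMatching S g
    matching-resp-≗ {f} {g} f≗g matched x x∈S with matched x x∈S
    ... | fx∈S , x~fx , ffx≡x =
      subst (_∈ S) (f≗g x) fx∈S ,
      subst (Adj F x) (f≗g x) x~fx ,
      trans (sym (f≗g (g x))) (trans (cong f (sym (f≗g x))) ffx≡x)

  vMinimum-exists : ∀ v → Σ (Subset n) (λ S → PairedDominating F S × v ∈ S) →
    Σ (Subset n) (VMinimum F v)
  vMinimum-exists v inhabited
    with minimal-subset (λ S → (dominating? S ×-dec perfectMatching? S) ×-dec v ∈? S) inhabited
  ... | S , (pd , v∈S) , minimal = S , pd , v∈S , λ S′ pd′ v∈S′ → minimal S′ (pd′ , v∈S′)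

lemma3 : {n : ℕ} (F : ArcModel n) (v pt ph : Fin n) →
    MaximalArc F v → IsTailPartner F v pt → IsHeadPartner F v ph →
    Σ (Subset n) (λ S → PairedDominating F S × v ∈ S) →
    Σ (Subset n) (λ S → VMinimum F v S × (pt ∈ S ⊎ ph ∈ S))
lemma3 F v pt ph maximal tail head inhabited with vMinimum-exists F v inhabited
... | S , vmin@((dom , mate , matched) , v∈S , minimal)
  with pt ∈? S | ph ∈? S | neighbour-arc-covered F maximal tail head (proj₁ (proj₂ (matched v v∈S)))
... | yes pt∈S | _        | _            = S , vmin , inj₁ pt∈S
... | no _     | yes ph∈S | _            = S , vmin , inj₂ ph∈S
... | no pt∉S  | no _     | inj₁ covered =
  _ , Prod.map₂ inj₁ (replace-partner-vMinimum F mate dom matched v∈S minimal pt∉S (proj₁ tail) covered)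
... | no _     | no ph∉S  | inj₂ covered =
  _ , Prod.map₂ inj₂ (replace-partner-vMinimum F mate dom matched v∈S minimal ph∉S (proj₁ head) covered)
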